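{- For every integer $n\geq 8$ there exists a $2$-strong non-Hamiltonian digraph of order $n$ in which $n-1$ of the vertices have degree at least $n$.
   Context: All digraphs are finite, without loops and without multiple arcs (opposite arcs $xy$ and $yx$ may both be present). For a vertex $x$, $d(x)=d^+(x)+d^-(x)$. A digraph $D$ is $k$-strong if $|V(D)|\geq k+1$ and $D-A$ is strongly connected for every set $A$ of at most $k-1$ vertices. A digraph is Hamiltonian if it contains a directed cycle through all its vertices. -}

module Defs where

open import Data.Nat using (ℕ; zero; suc; _+_; _∸_; _≤_)
open import Data.Bool using (Bool; true; false; T)
open import Data.Fin using (Fin; zero; suc; inject₁; fromℕ)
open import Data.Fin.Subset using (Subset; ∣_∣; _∈_; _∉_)
open import Data.Vec using (tabulate)
open import Data.Product using (Σ; _×_)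
open import Data.Empty using (⊥)
open import Function.Definitions using (Injective)
open import Relation.Binary.PropositionalEquality using (_≡_)

-- A finite digraph on vertex set Fin n: arc relation given by a Bool
-- matrix (so no multiple arcs), loopless; opposite arcs allowed.
record Digraph (n : ℕ) : Set where
  field
    arc     : Fin n → Fin n → Bool
    loopless : ∀ x → arc x x ≡ false
open Digraph public

Arc : ∀ {n} → Digraph n → Fin n → Fin n → Set
Arc D x y = T (arc D x y)

outdeg : ∀ {n} → Digraph n → Fin n → ℕ
outdeg D x = ∣ tabulate (λ y → arc D x y) ∣

indeg : ∀ {n} → Digraph n → Fin n → ℕ
indeg D x = ∣ tabulate (λ y → arc D y x) ∣

deg : ∀ {n} → Digraph n → Fin n → ℕ
deg D x = outdeg D x + indeg D x

-- Reach D S u v : there is a directed walk from u to v all of whose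
-- vertices lie in S (u is assumed in S by the caller).
data Reach {n} (D : Digraph n) (S : Subset n) : Fin n → Fin n → Set where
  here : ∀ {u} → Reach D S u u
  step : ∀ {u w v} → Arc D u w → w ∈ S → Reach D S w v → Reach D S u v

StronglyConnectedMinus : ∀ {n} → Digraph n → Subset n → Set
StronglyConnectedMinus {n} D A =
  ∀ (u v : Fin n) → u ∉ A → v ∉ A → Reach D (Data.Fin.Subset.∁ A) u v

KStrong : ∀ {n} → ℕ → Digraph n → Set
KStrong {n} k D =
  (suc k ≤ n) × (∀ (A : Subset n) → ∣ A ∣ ≤ k ∸ 1 → StronglyConnectedMinus D A)

-- Hamiltonian: a directed cycle through all vertices, given as an
-- injective (hence bijective) enumeration f 0, f 1, ..., f m of the
-- vertices with arcs f i → f (i+1) and f m → f 0.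
Hamiltonian : ∀ {n} → Digraph n → Set
Hamiltonian {zero} D = ⊥
Hamiltonian {suc m} D =
  Σ (Fin (suc m) → Fin (suc m)) λ f →
    Injective _≡_ _≡_ f
    × (∀ (i : Fin m) → Arc D (f (inject₁ i)) (f (suc i)))
    × Arc D (f (fromℕ m)) (f zero)

module Submission where

-- The vertices are five named vertices z, p, q, s, h followed by m extra
-- vertices, some of them in a set I and some in a set O.  A pair u → v is
-- "allowed" if it respects six local rules: z only sends to p, q; z only
-- receives from p, s; q only sends to p, h; s only receives from p, h; arcs
-- entering I come from s or h; arcs leaving O go to q or h.  The digraph D
-- has all allowed arcs.
--
-- Non-Hamiltonicity then holds for every digraph with allowed arcs only:
-- following the successor of z through the rules either closes a cycle
-- avoiding h or forbids entering I or leaving O.  For 2-strong connectivity,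
-- after deleting one vertex either h survives and every vertex reaches h and
-- is reached from h in at most two steps, or h was deleted and p plays that
-- role.  The degree bounds are computed for two layouts of the extra
-- vertices: n = 8 (three vertices in I ∩ O) and n = 9 + k (two vertices in
-- I only, the rest in O only); the theorem splits n into these two cases.

open import Defs
open import Data.Nat using (ℕ; zero; suc; _+_; _≤_; _≤?_; s≤s; z≤n)
open import Data.Nat.Properties
  using (≤-trans; ≤-refl; ≤-reflexive; 1+n≰n; +-mono-≤; m≤m+n; m≤n+m; suc-injective;
         +-commutativeSemigroup; m≤n⇒∃[o]m+o≡n)
open import Algebra.Properties.CommutativeSemigroup +-commutativeSemigroup using (interchange)
open import Data.Bool using (Bool; true; false; T; not)
open import Data.Bool.Properties using (T-≡)
open import Data.Fin using (Fin; zero; suc; inject₁; fromℕ; punchOut)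
open import Data.Fin.Properties
  using (_≟_; inject₁-injective; fromℕ≢inject₁; punchOut-injective; injective⇒≤; any?; all?)
  renaming (suc-injective to Fin-suc-injective)
open import Data.Fin.Subset using (Subset; ∣_∣; _∈_; _∉_; ∁)
open import Data.Fin.Subset.Properties using (x∉p⇒x∈∁p; _∈?_; x∈p∧x≢y⇒x∈p-y; x∈p⇒∣p-x∣<∣p∣)
open import Data.Vec using (tabulate)
open import Data.Product using (Σ; _×_; _,_; proj₁; proj₂)
open import Data.Sum using (_⊎_; inj₁; inj₂; [_,_]; [_,_]′)
open import Data.Unit using (tt)
open import Data.Empty using (⊥; ⊥-elim)
open import Function using (_∘_; id; const)
open import Function.Bundles using (Equivalence)
open import Function.Definitions using (Injective)
open import Relation.Nullary using (¬_; Dec; yes; no; ¬?)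
open import Relation.Nullary.Decidable
  using (⌊_⌋; isYes≗does; T?; _×-dec_; _⊎-dec_; _→-dec_; map′; dec-false; decidable-stable;
         fromWitness; toWitness)
open import Relation.Unary using (Decidable)
open import Relation.Binary.PropositionalEquality using (_≡_; refl; sym; trans; cong; subst; _≢_)

-- An injective endomap of Fin n is surjective: a missed value could be
-- punched out, giving an injection Fin n → Fin (n - 1).
injective⇒surjective : ∀ {n} (f : Fin n → Fin n) → Injective _≡_ _≡_ f →
  ∀ y → Σ (Fin n) λ x → f x ≡ y
injective⇒surjective f f-injective y with any? (λ x → f x ≟ y)
... | yes hit = hit
injective⇒surjective {suc n} f f-injective y | no miss = ⊥-elim (1+n≰n (injective⇒≤ g-injective))
  where
  y≢f : ∀ x → y ≢ f x
  y≢f x y≡fx = miss (x , sym y≡fx)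
  g-injective : Injective _≡_ _≡_ (λ x → punchOut (y≢f x))
  g-injective e = f-injective (punchOut-injective (y≢f _) (y≢f _) e)

at-most-one : ∀ {n} {A : Subset n} {x y : Fin n} → ∣ A ∣ ≤ 1 → x ∈ A → y ∈ A → x ≡ y
at-most-one {A = A} {x} {y} |A|≤1 x∈A y∈A with x ≟ y
... | yes x≡y = x≡y
... | no x≢y with ≤-trans (s≤s (x∈p⇒∣p-x∣<∣p∣ (x∈p∧x≢y⇒x∈p-y x∈A x≢y)))
                          (≤-trans (x∈p⇒∣p-x∣<∣p∣ y∈A) |A|≤1)
...   | s≤s ()

reach-trans : ∀ {n} {D : Digraph n} {S : Subset n} {u w v} →
  Reach D S u w → Reach D S w v → Reach D S u v
reach-trans here r = r
reach-trans (step a w∈S r₁) r = step a w∈S (reach-trans r₁ r)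

via-hub : ∀ {n} {D : Digraph n} {A : Subset n} (c : Fin n) →
  (∀ u → u ∉ A → Reach D (∁ A) u c) → (∀ v → v ∉ A → Reach D (∁ A) c v) →
  StronglyConnectedMinus D A
via-hub c to-c from-c u v u∉A v∉A = reach-trans (to-c u u∉A) (from-c v v∉A)

count-full : ∀ {n} {g : Fin n → Bool} → (∀ i → g i ≡ true) → ∣ tabulate g ∣ ≡ n
count-full {zero} _ = refl
count-full {suc n} {g} g-full with g zero | g-full zero
... | .true | refl = cong suc (count-full (g-full ∘ suc))

count-all-but-one : ∀ {n} {g : Fin n → Bool} (j : Fin n) → g j ≡ false →
  (∀ i → i ≢ j → g i ≡ true) → suc ∣ tabulate g ∣ ≡ n
count-all-but-one {suc n} {g} zero gj≡false others with g zero | gj≡false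
... | .false | refl = cong suc (count-full (λ i → others (suc i) (λ ())))
count-all-but-one {suc n} {g} (suc j) gj≡false others with g zero | others zero (λ ())
... | .true | refl =
  cong suc (count-all-but-one j gj≡false (λ i i≢j → others (suc i) (i≢j ∘ Fin-suc-injective)))

-- The arithmetic shape of the degree bounds: a fixed part plus a tail part.
tail-bound : ∀ a b {c t₁ t₂ k} → c ≤ a + b → k ≤ t₁ + t₂ → c + k ≤ (a + t₁) + (b + t₂)
tail-bound a b {t₁ = t₁} {t₂} c≤a+b k≤t =
  ≤-trans (+-mono-≤ c≤a+b k≤t) (≤-reflexive (interchange a b t₁ t₂))

data Next {m : ℕ} : Fin (suc m) → Fin (suc m) → Set where
  step : ∀ i → Next (inject₁ i) (suc i)
  wrap : Next (fromℕ m) zero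

last-or-inject : ∀ {m} (i : Fin (suc m)) → i ≡ fromℕ m ⊎ Σ (Fin m) λ j → i ≡ inject₁ j
last-or-inject {zero} zero = inj₁ refl
last-or-inject {suc m} zero = inj₂ (zero , refl)
last-or-inject {suc m} (suc i) with last-or-inject i
... | inj₁ i≡last = inj₁ (cong suc i≡last)
... | inj₂ (j , i≡j) = inj₂ (suc j , cong suc i≡j)

next-total : ∀ {m} (i : Fin (suc m)) → Σ (Fin (suc m)) (Next i)
next-total i with last-or-inject i
... | inj₁ refl = zero , wrap
... | inj₂ (j , refl) = suc j , step j

next-surjective : ∀ {m} (j : Fin (suc m)) → Σ (Fin (suc m)) λ i → Next i j
next-surjective zero = fromℕ _ , wrap
next-surjective (suc j) = inject₁ j , step j

next-functional : ∀ {m} {i i′ j j′ : Fin (suc m)} → Next i j → Next i′ j′ → i ≡ i′ → j ≡ j′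
next-functional (step i) (step i′) e = cong suc (inject₁-injective e)
next-functional (step i) wrap e = ⊥-elim (fromℕ≢inject₁ (sym e))
next-functional wrap (step i′) e = ⊥-elim (fromℕ≢inject₁ e)
next-functional wrap wrap _ = refl

next-injective : ∀ {m} {i i′ j j′ : Fin (suc m)} → Next i j → Next i′ j′ → j ≡ j′ → i ≡ i′
next-injective (step i) (step i′) e = cong inject₁ (Fin-suc-injective e)
next-injective wrap wrap _ = refl

Ascent : ∀ {m} → (Fin (suc m) → Set) → Set
Ascent {m} P = Σ (Fin m) λ i → ¬ P (inject₁ i) × P (suc i)

shift-ascent : ∀ {m} {P : Fin (suc (suc m)) → Set} → Ascent (P ∘ suc) → Ascent P
shift-ascent (i , ¬Pi , Pi+1) = suc i , ¬Pi , Pi+1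

ascent-from-zero : ∀ {m} {P : Fin (suc m) → Set} → Decidable P →
  ¬ P zero → ∀ k → P k → Ascent P
ascent-from-zero P? ¬P0 zero Pk = ⊥-elim (¬P0 Pk)
ascent-from-zero {suc m} {P} P? ¬P0 (suc k) Pk with P? (suc zero)
... | yes P1 = zero , ¬P0 , P1
... | no ¬P1 = shift-ascent {P = P} (ascent-from-zero (P? ∘ suc) ¬P1 k Pk)

ascent-to-last : ∀ {m} {P : Fin (suc m) → Set} → Decidable P →
  ∀ k → ¬ P k → P (fromℕ m) → Ascent P
ascent-to-last {zero} P? zero ¬Pk Plast = ⊥-elim (¬Pk Plast)
ascent-to-last {suc m} P? zero ¬P0 Plast = ascent-from-zero P? ¬P0 (fromℕ (suc m)) Plast
ascent-to-last {suc m} {P} P? (suc k) ¬Pk Plast =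
  shift-ascent {P = P} (ascent-to-last (P? ∘ suc) k ¬Pk Plast)

Entry : ∀ {m} → (Fin (suc m) → Set) → Set
Entry {m} P = Σ (Fin (suc m)) λ i → Σ (Fin (suc m)) λ j → Next i j × ¬ P i × P j

ascent⇒entry : ∀ {m} {P : Fin (suc m) → Set} → Ascent P → Entry P
ascent⇒entry (i , ¬Pi , Pi+1) = inject₁ i , suc i , step i , ¬Pi , Pi+1

-- Going once around the cycle, a decidable property that holds somewhere
-- and fails somewhere is entered at some step: either at a linear ascent or
-- at the wrap-around step m → 0.
cyclic-entry : ∀ {m} {P : Fin (suc m) → Set} → Decidable P → ∀ {a b} → P a → ¬ P b → Entry P
cyclic-entry {m} P? {a} {b} Pa ¬Pb with P? zero
... | no ¬P0 = ascent⇒entry (ascent-from-zero P? ¬P0 a Pa)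
... | yes P0 with P? (fromℕ m)
...   | no ¬Plast = fromℕ m , zero , wrap , ¬Plast , P0
...   | yes Plast = ascent⇒entry (ascent-to-last P? b ¬Pb Plast)

module HamiltonianCycle {m : ℕ} {D : Digraph (suc m)}
  (f : Fin (suc m) → Fin (suc m)) (f-injective : Injective _≡_ _≡_ f)
  (path : ∀ i → Arc D (f (inject₁ i)) (f (suc i))) (closing : Arc D (f (fromℕ m)) (f zero)) where

  Succ : Fin (suc m) → Fin (suc m) → Set
  Succ u v = Σ (Fin (suc m)) λ i → Σ (Fin (suc m)) λ j → Next i j × f i ≡ u × f j ≡ v

  succ-arc : ∀ {u v} → Succ u v → Arc D u v
  succ-arc (_ , _ , step i , refl , refl) = path i
  succ-arc (_ , _ , wrap , refl , refl) = closing

  succ-total : ∀ u → Σ (Fin (suc m)) (Succ u)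
  succ-total u with injective⇒surjective f f-injective u
  ... | i , fi≡u with next-total i
  ...   | j , i→j = f j , i , j , i→j , fi≡u , refl

  succ-surjective : ∀ v → Σ (Fin (suc m)) λ u → Succ u v
  succ-surjective v with injective⇒surjective f f-injective v
  ... | j , fj≡v with next-surjective j
  ...   | i , i→j = f i , i , j , i→j , refl , fj≡v

  succ-functional : ∀ {u v v′} → Succ u v → Succ u v′ → v ≡ v′
  succ-functional (i , j , i→j , refl , refl) (i′ , j′ , i′→j′ , fi′≡fi , refl) =
    cong f (next-functional i→j i′→j′ (f-injective (sym fi′≡fi)))

  succ-injective : ∀ {u u′ v} → Succ u v → Succ u′ v → u ≡ u′
  succ-injective (i , j , i→j , refl , refl) (i′ , j′ , i′→j′ , refl , fj′≡fj) =
    cong f (next-injective i→j i′→j′ (f-injective (sym fj′≡fj)))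

  entry : ∀ {P : Fin (suc m) → Set} → Decidable P → ∀ {a b} → P a → ¬ P b →
    Σ (Fin (suc m)) λ u → Σ (Fin (suc m)) λ v → Succ u v × ¬ P u × P v
  entry {P} P? {a} {b} Pa ¬Pb
    with injective⇒surjective f f-injective a | injective⇒surjective f f-injective b
  ... | i , refl | j , refl with cyclic-entry {P = P ∘ f} (P? ∘ f) Pa ¬Pb
  ...   | i′ , j′ , i′→j′ , ¬Pi′ , Pj′ = f i′ , f j′ , (i′ , j′ , i′→j′ , refl , refl) , ¬Pi′ , Pj′

  exit : ∀ {P : Fin (suc m) → Set} → Decidable P → ∀ {a b} → P a → ¬ P b →
    Σ (Fin (suc m)) λ u → Σ (Fin (suc m)) λ v → Succ u v × P u × ¬ P v
  exit P? Pa ¬Pb with entry (¬? ∘ P?) ¬Pb (λ ¬Pa → ¬Pa Pa)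
  ... | u , v , u→v , ¬¬Pu , ¬Pv = u , v , u→v , decidable-stable (P? u) ¬¬Pu , ¬Pv

  no-closed-set : ∀ {X : Fin (suc m) → Set} → Decidable X → ∀ {a b} → X a → ¬ X b →
    ¬ (∀ {v} → X v → Σ (Fin (suc m)) λ u → Succ u v × X u)
  no-closed-set {X} X? Xa ¬Xb closed with entry X? Xa ¬Xb
  ... | u , v , u→v , ¬Xu , Xv with closed Xv
  ...   | u′ , u′→v , Xu′ = ¬Xu (subst X (succ-injective u′→v u→v) Xu′)

module Vertices where
  pattern z = zero
  pattern p = suc zero
  pattern q = suc (suc zero)
  pattern s = suc (suc (suc zero))
  pattern h = suc (suc (suc (suc zero)))
  pattern extra j = suc (suc (suc (suc (suc j))))

module Construction {m : ℕ} (I O : Fin m → Bool) where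
  open Vertices

  Vertex : Set
  Vertex = Fin (5 + m)

  on-extras : (Fin m → Bool) → Vertex → Bool
  on-extras X (extra j) = X j
  on-extras X _ = false

  InI InO : Vertex → Set
  InI v = T (on-extras I v)
  InO v = T (on-extras O v)

  InI? : Decidable InI
  InI? v = T? (on-extras I v)

  InO? : Decidable InO
  InO? v = T? (on-extras O v)

  record Allowed (u v : Vertex) : Set where
    field
      fromZ  : u ≡ z → v ≡ p ⊎ v ≡ q
      intoZ  : v ≡ z → u ≡ p ⊎ u ≡ s
      fromQ  : u ≡ q → v ≡ p ⊎ v ≡ h
      intoS  : v ≡ s → u ≡ p ⊎ u ≡ h
      intoI  : InI v → ¬ InI u → u ≡ s ⊎ u ≡ h
      outOfO : InO u → ¬ InO v → v ≡ q ⊎ v ≡ h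

  allowed? : ∀ u v → Dec (Allowed u v)
  allowed? u v = map′
    (λ (a , b , c , d , e , g) →
      record { fromZ = a ; intoZ = b ; fromQ = c ; intoS = d ; intoI = e ; outOfO = g })
    (λ r → let open Allowed r in fromZ , intoZ , fromQ , intoS , intoI , outOfO)
    (     (u ≟ z →-dec (v ≟ p ⊎-dec v ≟ q))
    ×-dec (v ≟ z →-dec (u ≟ p ⊎-dec u ≟ s))
    ×-dec (u ≟ q →-dec (v ≟ p ⊎-dec v ≟ h))
    ×-dec (v ≟ s →-dec (u ≟ p ⊎-dec u ≟ h))
    ×-dec (InI? v →-dec ¬? (InI? u) →-dec (u ≟ s ⊎-dec u ≟ h))
    ×-dec (InO? u →-dec ¬? (InO? v) →-dec (v ≟ q ⊎-dec v ≟ h)))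

  adjacent? : ∀ u v → Dec (Allowed u v × u ≢ v)
  adjacent? u v = allowed? u v ×-dec ¬? (u ≟ v)

  D : Digraph (5 + m)
  D = record
    { arc = λ u v → ⌊ adjacent? u v ⌋
    ; loopless = λ x → trans (isYes≗does (adjacent? x x)) (dec-false (adjacent? x x) (λ (_ , x≢x) → x≢x refl))
    }

  arc-allowed : ∀ {u v} → Arc D u v → Allowed u v
  arc-allowed {u} {v} uv = proj₁ (toWitness {a? = adjacent? u v} uv)

  allowed-arc : ∀ {u v} → Allowed u v → u ≢ v → Arc D u v
  allowed-arc {u} {v} uv u≢v = fromWitness {a? = adjacent? u v} (uv , u≢v)

  module NonHamiltonian {E : Digraph (5 + m)} (allowed-arcs : ∀ {u v} → Arc E u v → Allowed u v)
    (wI : Σ Vertex InI) (wO : Σ Vertex InO)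
    (f : Vertex → Vertex) (f-injective : Injective _≡_ _≡_ f)
    (path : ∀ i → Arc E (f (inject₁ i)) (f (suc i))) (closing : Arc E (f (fromℕ (4 + m))) (f zero)) where
    open HamiltonianCycle {D = E} f f-injective path closing

    allowed-succ : ∀ {u v} → Succ u v → Allowed u v
    allowed-succ = allowed-arcs ∘ succ-arc

    -- With s → z → … and h → s on the cycle, the cycle cannot enter I:
    -- the only possible predecessors s, h of an I-vertex are taken.
    no-entry-into-I : Succ s z → Succ h s → ⊥
    no-entry-into-I s→z h→s with entry InI? {proj₁ wI} {z} (proj₂ wI) (λ ())
    ... | u , v , u→v , u∉I , v∈I with Allowed.intoI (allowed-succ u→v) v∈I u∉I
    ...   | inj₁ refl = subst InI (succ-functional u→v s→z) v∈I
    ...   | inj₂ refl = subst InI (succ-functional u→v h→s) v∈I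

    -- Dually, with z → q → h on the cycle, the cycle cannot leave O.
    no-exit-from-O : Succ z q → Succ q h → ⊥
    no-exit-from-O z→q q→h with exit InO? {proj₁ wO} {z} (proj₂ wO) (λ ())
    ... | u , v , u→v , u∈O , v∉O with Allowed.outOfO (allowed-succ u→v) u∈O v∉O
    ...   | inj₁ refl = subst InO (succ-injective u→v z→q) u∈O
    ...   | inj₂ refl = subst InO (succ-injective u→v q→h) u∈O

    ClosedExcept-z : (Vertex → Set) → Set
    ClosedExcept-z X = ∀ {v} → X v → v ≡ z ⊎ Σ Vertex λ u → Succ u v × X u

    close-at-z : ∀ {X Y : Vertex → Set} → ClosedExcept-z X → (∀ {u} → X u → Y u) →
      ∀ {b} → Succ b z → Y b → ∀ {v} → X v → Σ Vertex λ u → Succ u v × Y u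
    close-at-z closed X⊆Y b→z Yb Xv with closed Xv
    ... | inj₁ refl = _ , b→z , Yb
    ... | inj₂ (u , u→v , Xu) = u , u→v , X⊆Y Xu

    -- A stretch of the cycle from z to p that avoids h cannot be completed:
    -- the predecessor of z is p (the stretch closes up), or s, whose own
    -- predecessor is p (it closes up with s added) or h (I is never entered).
    return-to-z : ∀ {X : Vertex → Set} → Decidable X → X z → X p → ¬ X h → ClosedExcept-z X → ⊥
    return-to-z {X} X? Xz Xp ¬Xh closed with succ-surjective z
    ... | b , b→z with Allowed.intoZ (allowed-succ b→z) refl
    ...   | inj₁ refl = no-closed-set X? Xz ¬Xh (close-at-z closed id b→z Xp)
    ...   | inj₂ refl with succ-surjective s
    ...     | c , c→s with Allowed.intoS (allowed-succ c→s) refl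
    ...       | inj₂ refl = no-entry-into-I b→z c→s
    ...       | inj₁ refl = no-closed-set (λ v → v ≟ s ⊎-dec X? v) (inj₂ Xz) [ (λ ()) , ¬Xh ] closed-with-s
      where
      closed-with-s : ∀ {v} → v ≡ s ⊎ X v → Σ Vertex λ u → Succ u v × (u ≡ s ⊎ X u)
      closed-with-s (inj₁ refl) = p , c→s , inj₂ Xp
      closed-with-s (inj₂ Xv) = close-at-z closed inj₂ b→z (inj₁ refl) Xv

    -- The successor of z is p (a stretch z → p), or q; the successor of q
    -- is h (O is never left) or p (a stretch z → q → p).
    absurd : ⊥
    absurd with succ-total z
    ... | a , z→a with Allowed.fromZ (allowed-succ z→a) refl
    ...   | inj₁ refl = return-to-z (λ v → v ≟ z ⊎-dec v ≟ p) (inj₁ refl) (inj₂ refl)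
            [ (λ ()) , (λ ()) ]
            λ { (inj₁ refl) → inj₁ refl ; (inj₂ refl) → inj₂ (z , z→a , inj₁ refl) }
    ...   | inj₂ refl with succ-total q
    ...     | d , q→d with Allowed.fromQ (allowed-succ q→d) refl
    ...       | inj₂ refl = no-exit-from-O z→a q→d
    ...       | inj₁ refl = return-to-z (λ v → v ≟ z ⊎-dec v ≟ q ⊎-dec v ≟ p) (inj₁ refl) (inj₂ (inj₂ refl))
            [ (λ ()) , [ (λ ()) , (λ ()) ] ]
            λ { (inj₁ refl) → inj₁ refl
              ; (inj₂ (inj₁ refl)) → inj₂ (z , z→a , inj₁ refl)
              ; (inj₂ (inj₂ refl)) → inj₂ (q , q→d , inj₂ (inj₁ refl)) }

  non-hamiltonian : ∀ {E : Digraph (5 + m)} → (∀ {u v} → Arc E u v → Allowed u v) →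
    Σ Vertex InI → Σ Vertex InO → ¬ Hamiltonian E
  non-hamiltonian {E} allowed-arcs wI wO (f , f-injective , path , closing) =
    NonHamiltonian.absurd {E} allowed-arcs wI wO f f-injective path closing

  into-h : ∀ {u} → u ≢ z → Allowed u h
  into-h u≢z = record
    { fromZ = ⊥-elim ∘ u≢z ; intoZ = λ () ; fromQ = λ _ → inj₂ refl
    ; intoS = λ () ; intoI = λ () ; outOfO = λ _ _ → inj₂ refl }

  out-of-h : ∀ {v} → v ≢ z → Allowed h v
  out-of-h v≢z = record
    { fromZ = λ () ; intoZ = ⊥-elim ∘ v≢z ; fromQ = λ ()
    ; intoS = λ _ → inj₂ refl ; intoI = λ _ _ → inj₂ refl ; outOfO = λ () }

  into-p : ∀ {u} → ¬ InO u → Allowed u p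
  into-p u∉O = record
    { fromZ = λ _ → inj₁ refl ; intoZ = λ () ; fromQ = λ _ → inj₁ refl
    ; intoS = λ () ; intoI = λ () ; outOfO = ⊥-elim ∘ u∉O }

  into-q : ∀ {u} → u ≢ q → Allowed u q
  into-q u≢q = record
    { fromZ = λ _ → inj₂ refl ; intoZ = λ () ; fromQ = ⊥-elim ∘ u≢q
    ; intoS = λ () ; intoI = λ () ; outOfO = λ _ _ → inj₁ refl }

  out-of-p : ∀ {v} → ¬ InI v → Allowed p v
  out-of-p v∉I = record
    { fromZ = λ () ; intoZ = λ _ → inj₁ refl ; fromQ = λ ()
    ; intoS = λ _ → inj₁ refl ; intoI = ⊥-elim ∘ v∉I ; outOfO = λ () }

  out-of-s : ∀ {v} → v ≢ s → Allowed s v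
  out-of-s v≢s = record
    { fromZ = λ () ; intoZ = λ _ → inj₂ refl ; fromQ = λ ()
    ; intoS = ⊥-elim ∘ v≢s ; intoI = λ _ _ → inj₁ refl ; outOfO = λ () }

  module Connectivity (A : Subset (5 + m)) (|A|≤1 : ∣ A ∣ ≤ 1) where

    edge : ∀ {u v} → Allowed u v → u ≢ v → v ∉ A → Reach D (∁ A) u v
    edge uv u≢v v∉A = step (allowed-arc uv u≢v) (x∉p⇒x∈∁p v∉A) here

    one-of : ∀ {x y} → x ≢ y → x ∉ A ⊎ y ∉ A
    one-of {x} x≢y with x ∈? A
    ... | no x∉A = inj₁ x∉A
    ... | yes x∈A = inj₂ (λ y∈A → x≢y (at-most-one |A|≤1 x∈A y∈A))

    only-h : h ∈ A → ∀ {v} → v ≢ h → v ∉ A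
    only-h h∈A v≢h v∈A = v≢h (at-most-one |A|≤1 v∈A h∈A)

    to-h : h ∉ A → ∀ u → u ∉ A → Reach D (∁ A) u h
    to-h h∉A u u∉A with u ≟ h | u ≟ z
    ... | yes refl | _ = here
    ... | no u≢h | no u≢z = edge (into-h u≢z) u≢h h∉A
    ... | no _ | yes refl with one-of {q} {p} (λ ())
    ...   | inj₁ q∉A = reach-trans (edge (into-q (λ ())) (λ ()) q∉A) (edge (into-h (λ ())) (λ ()) h∉A)
    ...   | inj₂ p∉A = reach-trans (edge (into-p (λ ())) (λ ()) p∉A) (edge (into-h (λ ())) (λ ()) h∉A)

    from-h : h ∉ A → ∀ v → v ∉ A → Reach D (∁ A) h v
    from-h h∉A v v∉A with v ≟ h | v ≟ z
    ... | yes refl | _ = here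
    ... | no v≢h | no v≢z = edge (out-of-h v≢z) (v≢h ∘ sym) v∉A
    ... | no _ | yes refl with one-of {s} {p} (λ ())
    ...   | inj₁ s∉A = reach-trans (edge (out-of-h (λ ())) (λ ()) s∉A) (edge (out-of-s (λ ())) (λ ()) v∉A)
    ...   | inj₂ p∉A = reach-trans (edge (out-of-h (λ ())) (λ ()) p∉A) (edge (out-of-p (λ ())) (λ ()) v∉A)

    to-p : h ∈ A → ∀ u → u ∉ A → Reach D (∁ A) u p
    to-p h∈A u u∉A with u ≟ p | InO? u
    ... | yes refl | _ = here
    ... | no u≢p | no u∉O = edge (into-p u∉O) u≢p (only-h h∈A (λ ()))
    ... | no _ | yes u∈O = reach-trans (edge (into-q u≢q) u≢q (only-h h∈A (λ ())))
                                       (edge (into-p (λ ())) (λ ()) (only-h h∈A (λ ())))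
      where u≢q : u ≢ q
            u≢q refl = u∈O

    from-p : h ∈ A → ∀ v → v ∉ A → Reach D (∁ A) p v
    from-p h∈A v v∉A with v ≟ p | InI? v
    ... | yes refl | _ = here
    ... | no v≢p | no v∉I = edge (out-of-p v∉I) (v≢p ∘ sym) v∉A
    ... | no _ | yes v∈I = reach-trans (edge (out-of-p (λ ())) (λ ()) (only-h h∈A (λ ())))
                                       (edge (out-of-s v≢s) (v≢s ∘ sym) v∉A)
      where v≢s : v ≢ s
            v≢s refl = v∈I

  two-strong : KStrong 2 D
  two-strong = s≤s (s≤s (s≤s z≤n)) , connected
    where
    connected : ∀ A → ∣ A ∣ ≤ 1 → StronglyConnectedMinus D A
    connected A |A|≤1 with h ∈? A
    ... | no h∉A = via-hub h (to-h h∉A) (from-h h∉A)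
      where open Connectivity A |A|≤1
    ... | yes h∈A = via-hub p (to-p h∈A) (from-p h∈A)
      where open Connectivity A |A|≤1

Example : ℕ → Set
Example n = Σ (Digraph n) λ D → KStrong 2 D × ¬ Hamiltonian D ×
  Σ (Fin n) λ c → ∀ (x : Fin n) → ¬ x ≡ c → n ≤ deg D x

module Order8 where
  open Vertices
  open Construction {3} (const true) (const true)

  degrees : ∀ x → x ≡ z ⊎ 8 ≤ deg D x
  degrees = toWitness {a? = all? (λ x → x ≟ z ⊎-dec 8 ≤? deg D x)} _

  example : Example 8
  example = D , two-strong , non-hamiltonian {D} arc-allowed (extra zero , tt) (extra zero , tt) ,
            z , λ x x≢z → [ ⊥-elim ∘ x≢z , id ]′ (degrees x)

-- Order 9 + k: the first two extra vertices W lie in I only, the remaining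
-- 2 + k extra vertices Y lie in O only.  Degrees: p 12 + k, q and s 10 + k,
-- h 14 + 2k, each W 9 + k, each Y 9 + 2k.
module Order9+ (k : ℕ) where
  open Vertices

  first-two : Fin (4 + k) → Bool
  first-two zero = true
  first-two (suc zero) = true
  first-two _ = false

  open Construction {4 + k} first-two (not ∘ first-two)

  Y : Fin (2 + k) → Vertex
  Y i = extra (suc (suc i))

  Y-arc : ∀ {i i′} → i ≢ i′ → arc D (Y i) (Y i′) ≡ true
  Y-arc i≢i′ = Equivalence.to T-≡ (allowed-arc Y-allowed (λ { refl → i≢i′ refl }))
    where
    Y-allowed : ∀ {i i′} → Allowed (Y i) (Y i′)
    Y-allowed = record
      { fromZ = λ () ; intoZ = λ () ; fromQ = λ () ; intoS = λ ()
      ; intoI = λ () ; outOfO = λ _ Y∉O → ⊥-elim (Y∉O tt) }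

  k≤tail : ∀ {g : Fin k → Bool} → (∀ i → g i ≡ true) → k ≤ ∣ tabulate g ∣
  k≤tail g-full = ≤-reflexive (sym (count-full g-full))

  1+k≤others : ∀ {t} → suc t ≡ 2 + k → 1 + k ≤ t
  1+k≤others e = ≤-reflexive (sym (suc-injective e))

  degrees : ∀ x → x ≢ z → 9 + k ≤ deg D x
  degrees z x≢z = ⊥-elim (x≢z refl)
  degrees p _ = tail-bound 6 6 (m≤m+n 9 3) (≤-trans (k≤tail λ _ → refl) (m≤m+n _ _))
  degrees q _ = tail-bound 2 8 (m≤m+n 9 1) (≤-trans (k≤tail λ _ → refl) (m≤n+m _ _))
  degrees s _ = tail-bound 8 2 (m≤m+n 9 1) (≤-trans (k≤tail λ _ → refl) (m≤m+n _ _))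
  degrees h _ = tail-bound 7 7 (m≤m+n 9 5) (≤-trans (k≤tail λ _ → refl) (m≤m+n _ _))
  degrees (extra zero) _ = tail-bound 6 3 ≤-refl (≤-trans (k≤tail λ _ → refl) (m≤m+n _ _))
  degrees (extra (suc zero)) _ = tail-bound 6 3 ≤-refl (≤-trans (k≤tail λ _ → refl) (m≤m+n _ _))
  degrees (extra (suc (suc j))) _ =
    tail-bound 2 5 {c = 7} ≤-refl (+-mono-≤ (≤-trans (s≤s z≤n) (1+k≤others out-Y)) (1+k≤others in-Y))
    where
    out-Y = count-all-but-one {g = λ i → arc D (Y j) (Y i)} j (loopless D (Y j)) (λ i i≢j → Y-arc (i≢j ∘ sym))
    in-Y = count-all-but-one {g = λ i → arc D (Y i) (Y j)} j (loopless D (Y j)) (λ i i≢j → Y-arc i≢j)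

  example : Example (9 + k)
  example = D , two-strong , non-hamiltonian {D} arc-allowed (extra zero , tt) (Y zero , tt) , z , degrees

theorem3p4 : ∀ (n : ℕ) → 8 ≤ n →
    Σ (Digraph n) λ D →
    KStrong 2 D
    × ¬ Hamiltonian D
    × Σ (Fin n) λ z → ∀ (x : Fin n) → ¬ x ≡ z → n ≤ deg D x
theorem3p4 n 8≤n with m≤n⇒∃[o]m+o≡n 8≤n
... | zero , refl = Order8.example
... | suc k , refl = Order9+.example k
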